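{- Let $R=(r_{st})_{n\times n}$ be a complex matrix. For $1\leq i,j\leq n$ let $R_{ij}$ be the matrix obtained from $R$ by replacing the $(i,j)$ entry by $0$ (all other entries unchanged). Then $$(n^2-n)\,d_2(R)=\sum_{1\leq i,j\leq n}d_2(R_{ij}).$$
   Context: For a $k\times k$ matrix $X=(x_{st})$, the second immanant is $d_2(X)=\sum_{\sigma\in S_k}\chi_2(\sigma)\prod_{s=1}^k x_{s\sigma(s)}$, where $\chi_2$ is the irreducible character of $S_k$ corresponding to the partition $(2,1^{k-2})$; equivalently $d_2(X)=\sum_{i=1}^k x_{ii}\det(X(i))-\det(X)$, where $X(i)$ is $X$ with row and column $i$ deleted. -}

module Defs where

open import Level using (Level)
open import Algebra.Bundles using (CommutativeRing)
open import Data.Nat using (ℕ; zero; suc)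
open import Data.Fin using (Fin; zero; suc; toℕ; punchIn; _≟_)
open import Data.Bool using (if_then_else_; _∧_)
open import Relation.Nullary using (does)

module _ {c ℓ : Level} (𝓡 : CommutativeRing c ℓ) where
  open CommutativeRing 𝓡 hiding (zero)

  Matrix : ℕ → Set c
  Matrix n = Fin n → Fin n → Carrier

  Σ : ∀ {n} → (Fin n → Carrier) → Carrier
  Σ {zero} f = 0#
  Σ {suc n} f = f zero + Σ (λ i → f (suc i))

  signed : ℕ → Carrier → Carrier
  signed zero x = x
  signed (suc k) x = - signed k x

  fromℕ : ℕ → Carrier
  fromℕ zero = 0#
  fromℕ (suc k) = 1# + fromℕ k

  minor : ∀ {m} → Fin (suc m) → Fin (suc m) → Matrix (suc m) → Matrix m
  minor i j X s t = X (punchIn i s) (punchIn j t)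

  det : ∀ n → Matrix n → Carrier
  det zero X = 1#
  det (suc m) X = Σ (λ j → signed (toℕ j) (X zero j * det m (minor zero j X)))

  -- X(i): X with row and column i deleted; det of it (1 for a 1×1 X)
  principalMinorDet : ∀ {n} → Fin n → Matrix n → Carrier
  principalMinorDet {suc m} i X = det m (minor i i X)

  d₂ : ∀ {n} → Matrix n → Carrier
  d₂ {n} X = Σ (λ i → X i i * principalMinorDet i X) - det n X

  zeroEntry : ∀ {n} → Fin n → Fin n → Matrix n → Matrix n
  zeroEntry i j X s t = if does (s ≟ i) ∧ does (t ≟ j) then 0# else X s t

{-# OPTIONS --safe #-}
-- d₂ is additive in each row separately: so are det X and the diagonal terms x_kk det X(k)
-- (row i sits either in x_kk or in one row of X(k)).  For F additive in
-- row i, let E_ij be R with row i replaced by r_ij e_j.  Splitting row i of R as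
-- (row i of R_ij) + r_ij e_j gives F(R) = F(R_ij) + F(E_ij), while the rows r_ij e_j sum to
-- row i of R, so Σ_j F(E_ij) = F(R).  Hence Σ_j F(R_ij) + F(R) = n F(R), and summing over i
-- gives Σ_ij F(R_ij) = (n² - n) F(R).
module Submission where

open import Defs
open import Level using (Level; _⊔_)
open import Algebra.Bundles using (CommutativeRing)
open import Data.Nat using (ℕ; _*_; _∸_)
import Data.Nat as ℕ
open import Data.Nat.Properties using (m≤m*n; m∸n+n≡m)
open import Data.Fin using (Fin; zero; suc; punchIn; punchOut; toℕ; _≟_)
open import Data.Fin.Properties using (punchIn-punchOut; punchInᵢ≢i; punchIn-injective)
open import Data.Vec.Functional using (updateAt)
open import Data.Vec.Functional.Properties using (updateAt-updates; updateAt-minimal)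
open import Data.Bool using (if_then_else_)
open import Function using (_∘_)
open import Relation.Nullary using (does; yes; no)
open import Relation.Nullary.Negation using (contradiction)
open import Relation.Binary.PropositionalEquality as ≡ using (_≡_; _≢_)

n≤n*n : ∀ n → n ℕ.≤ n * n
n≤n*n ℕ.zero = ℕ.z≤n
n≤n*n n@(ℕ.suc _) = m≤m*n n n

module _ {c ℓ : Level} (𝓡 : CommutativeRing c ℓ) where
  open CommutativeRing 𝓡 hiding (zero) renaming (_*_ to _·_)
  open import Algebra.Properties.Ring ring using (-‿+-comm; x+x≈x⇒x≈0; +-cancelʳ)
  open import Algebra.Properties.CommutativeSemigroup +-commutativeSemigroup using (interchange)
  open import Algebra.Properties.Semiring.Sum semiring
    using (sum; sum-cong-≋; ∑-distrib-+; sum-replicate; sum-replicate-zero)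
  open import Algebra.Properties.Semiring.Mult semiring using (_×_; ×-homo-+; ×-assocˡ)
  open import Relation.Binary.Reasoning.Setoid setoid

  private variable
    m n : ℕ
    i : Fin n
    F G : Matrix 𝓡 n → Carrier

  Σ≡sum : (f : Fin n → Carrier) → Σ 𝓡 f ≡ sum f
  Σ≡sum {ℕ.zero} f = ≡.refl
  Σ≡sum {ℕ.suc n} f = ≡.cong (f zero +_) (Σ≡sum (f ∘ suc))

  Σ-cong : {f g : Fin n → Carrier} → (∀ i → f i ≈ g i) → Σ 𝓡 f ≈ Σ 𝓡 g
  Σ-cong {f = f} {g} f≈g = ≡.subst₂ _≈_ (≡.sym (Σ≡sum f)) (≡.sym (Σ≡sum g)) (sum-cong-≋ f≈g)

  Σ-distrib-+ : (f g : Fin n → Carrier) → Σ 𝓡 (λ i → f i + g i) ≈ Σ 𝓡 f + Σ 𝓡 g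
  Σ-distrib-+ f g = ≡.subst₂ _≈_
    (≡.sym (Σ≡sum (λ i → f i + g i))) (≡.sym (≡.cong₂ _+_ (Σ≡sum f) (Σ≡sum g))) (∑-distrib-+ f g)

  Σ-const : ∀ n (x : Carrier) → Σ 𝓡 {n} (λ _ → x) ≈ n × x
  Σ-const n x = ≡.subst (_≈ n × x) (≡.sym (Σ≡sum {n = n} (λ _ → x))) (sum-replicate n)

  Σ-0# : ∀ n → Σ 𝓡 {n} (λ _ → 0#) ≈ 0#
  Σ-0# n = ≡.subst (_≈ 0#) (≡.sym (Σ≡sum {n = n} (λ _ → 0#))) (sum-replicate-zero n)

  fromℕk·x≈k×x : ∀ k x → fromℕ 𝓡 k · x ≈ k × x
  fromℕk·x≈k×x ℕ.zero x = zeroˡ x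
  fromℕk·x≈k×x (ℕ.suc k) x = begin
    (1# + fromℕ 𝓡 k) · x    ≈⟨ distribʳ x 1# (fromℕ 𝓡 k) ⟩
    1# · x + fromℕ 𝓡 k · x  ≈⟨ +-cong (*-identityˡ x) (fromℕk·x≈k×x k x) ⟩
    x + k × x               ∎

  signed-cong : ∀ k {x y} → x ≈ y → signed 𝓡 k x ≈ signed 𝓡 k y
  signed-cong ℕ.zero x≈y = x≈y
  signed-cong (ℕ.suc k) x≈y = -‿cong (signed-cong k x≈y)

  det-cong : ∀ n {X Y : Matrix 𝓡 n} → (∀ s t → X s t ≈ Y s t) → det 𝓡 n X ≈ det 𝓡 n Y
  det-cong ℕ.zero X≈Y = refl
  det-cong (ℕ.suc m) X≈Y = Σ-cong λ j → signed-cong (toℕ j)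
    (*-cong (X≈Y zero j) (det-cong m λ s t → X≈Y (punchIn zero s) (punchIn j t)))

  AgreeOffRow : Fin n → Matrix 𝓡 n → Matrix 𝓡 n → Set ℓ
  AgreeOffRow i X Y = ∀ s t → s ≢ i → X s t ≈ Y s t

  AdditiveInRow : (Matrix 𝓡 n → Carrier) → Fin n → Set (c ⊔ ℓ)
  AdditiveInRow F i = ∀ X Y Z → AgreeOffRow i X Z → AgreeOffRow i Y Z →
    (∀ t → Z i t ≈ X i t + Y i t) → F Z ≈ F X + F Y

  IndependentOfRow : (Matrix 𝓡 n → Carrier) → Fin n → Set (c ⊔ ℓ)
  IndependentOfRow F i = ∀ X Z → AgreeOffRow i X Z → F X ≈ F Z

  additive-+ : AdditiveInRow F i → AdditiveInRow G i → AdditiveInRow (λ X → F X + G X) i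
  additive-+ {F = F} {G = G} F-add G-add X Y Z xz yz zi = begin
    F Z + G Z                  ≈⟨ +-cong (F-add X Y Z xz yz zi) (G-add X Y Z xz yz zi) ⟩
    (F X + F Y) + (G X + G Y)  ≈⟨ interchange (F X) (F Y) (G X) (G Y) ⟩
    (F X + G X) + (F Y + G Y)  ∎

  additive-Σ : {F : Fin m → Matrix 𝓡 n → Carrier} →
    (∀ k → AdditiveInRow (F k) i) → AdditiveInRow (λ X → Σ 𝓡 (λ k → F k X)) i
  additive-Σ {m = ℕ.zero} _ _ _ _ _ _ _ = sym (+-identityˡ 0#)
  additive-Σ {m = ℕ.suc m} F-add = additive-+ (F-add zero) (additive-Σ (F-add ∘ suc))

  additive-neg : AdditiveInRow F i → AdditiveInRow (λ X → - F X) i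
  additive-neg F-add X Y Z xz yz zi =
    trans (-‿cong (F-add X Y Z xz yz zi)) (sym (-‿+-comm _ _))

  additive-signed : ∀ k → AdditiveInRow F i → AdditiveInRow (λ X → signed 𝓡 k (F X)) i
  additive-signed ℕ.zero F-add = F-add
  additive-signed (ℕ.suc k) F-add = additive-neg (additive-signed k F-add)

  additive-·-independent : AdditiveInRow F i → IndependentOfRow G i →
    AdditiveInRow (λ X → F X · G X) i
  additive-·-independent {F = F} {G = G} F-add G-ind X Y Z xz yz zi = begin
    F Z · G Z              ≈⟨ *-congʳ (F-add X Y Z xz yz zi) ⟩
    (F X + F Y) · G Z      ≈⟨ distribʳ (G Z) (F X) (F Y) ⟩
    F X · G Z + F Y · G Z  ≈⟨ +-cong (*-congˡ (G-ind X Z xz)) (*-congˡ (G-ind Y Z yz)) ⟨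
    F X · G X + F Y · G Y  ∎

  independent-·-additive : IndependentOfRow G i → AdditiveInRow F i →
    AdditiveInRow (λ X → G X · F X) i
  independent-·-additive {G = G} {F = F} G-ind F-add X Y Z xz yz zi = begin
    G Z · F Z              ≈⟨ *-congˡ (F-add X Y Z xz yz zi) ⟩
    G Z · (F X + F Y)      ≈⟨ distribˡ (G Z) (F X) (F Y) ⟩
    G Z · F X + G Z · F Y  ≈⟨ +-cong (*-congʳ (G-ind X Z xz)) (*-congʳ (G-ind Y Z yz)) ⟨
    G X · F X + G Y · F Y  ∎

  entry-additive : (i t : Fin n) → AdditiveInRow (λ X → X i t) i
  entry-additive i t X Y Z _ _ zi = zi t

  entry-independent : {s : Fin n} (t : Fin n) → s ≢ i → IndependentOfRow (λ X → X s t) i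
  entry-independent t s≢i X Z xz = xz _ t s≢i

  agreeOffRow-minor : ∀ {X Y : Matrix 𝓡 (ℕ.suc n)} (k l : Fin (ℕ.suc n)) →
    AgreeOffRow (punchIn k i) X Y → AgreeOffRow i (minor 𝓡 k l X) (minor 𝓡 k l Y)
  agreeOffRow-minor {i = i} k l xy s t s≢i =
    xy (punchIn k s) (punchIn l t) (s≢i ∘ punchIn-injective k s i)

  additive-minor : (k l : Fin (ℕ.suc n)) → AdditiveInRow F i →
    AdditiveInRow (λ X → F (minor 𝓡 k l X)) (punchIn k i)
  additive-minor k l F-add X Y Z xz yz zi =
    F-add (minor 𝓡 k l X) (minor 𝓡 k l Y) (minor 𝓡 k l Z)
      (agreeOffRow-minor k l xz) (agreeOffRow-minor k l yz) (λ t → zi (punchIn l t))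

  det-minor-independent : (k l : Fin (ℕ.suc n)) →
    IndependentOfRow (λ X → det 𝓡 n (minor 𝓡 k l X)) k
  det-minor-independent k l X Z xz =
    det-cong _ λ s t → xz (punchIn k s) (punchIn l t) (punchInᵢ≢i k s)

  det-additive : ∀ n (i : Fin n) → AdditiveInRow (det 𝓡 n) i
  det-additive (ℕ.suc m) i = additive-Σ λ j → additive-signed (toℕ j) (term-additive j i)
    where
    term-additive : ∀ j i → AdditiveInRow (λ X → X zero j · det 𝓡 m (minor 𝓡 zero j X)) i
    term-additive j zero =
      additive-·-independent (entry-additive zero j) (det-minor-independent zero j)
    term-additive j (suc i) =
      independent-·-additive (entry-independent j λ ()) (additive-minor zero j (det-additive m i))

  diagonalTerm-additive : (k i : Fin (ℕ.suc n)) →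
    AdditiveInRow (λ X → X k k · principalMinorDet 𝓡 k X) i
  diagonalTerm-additive k i with k ≟ i
  ... | yes ≡.refl = additive-·-independent (entry-additive k k) (det-minor-independent k k)
  ... | no k≢i = independent-·-additive (entry-independent k k≢i)
    (≡.subst (AdditiveInRow _) (punchIn-punchOut k≢i)
      (additive-minor k k (det-additive _ (punchOut k≢i))))

  d₂-additive : (i : Fin n) → AdditiveInRow (d₂ 𝓡) i
  d₂-additive {n = ℕ.suc m} i =
    additive-+ (additive-Σ λ k → diagonalTerm-additive k i)
               (additive-neg (det-additive (ℕ.suc m) i))

  keepOnly : Fin n → (Fin n → Carrier) → Fin n → Carrier
  keepOnly j u t = if does (t ≟ j) then u t else 0#

  Σ-keepOnly : (u : Fin n → Carrier) (t : Fin n) → Σ 𝓡 (λ j → keepOnly j u t) ≈ u t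
  Σ-keepOnly {n = ℕ.suc n} u zero = trans (+-congˡ (Σ-0# n)) (+-identityʳ (u zero))
  Σ-keepOnly u (suc t) = trans (+-identityˡ _) (Σ-keepOnly (u ∘ suc) t)

  setRow : Fin n → (Fin n → Carrier) → Matrix 𝓡 n → Matrix 𝓡 n
  setRow i v X = updateAt X i λ _ → v

  setRow-updates : ∀ (i : Fin n) v X t → setRow i v X i t ≈ v t
  setRow-updates i v X t = reflexive (≡.cong (λ r → r t) (updateAt-updates i X))

  setRow-agrees : ∀ (i : Fin n) v X → AgreeOffRow i (setRow i v X) X
  setRow-agrees i v X s t s≢i = reflexive (≡.cong (λ r → r t) (updateAt-minimal s i X s≢i))

  zeroEntry-agrees : ∀ (i j : Fin n) R → AgreeOffRow i (zeroEntry 𝓡 i j R) R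
  zeroEntry-agrees i j R s t s≢i with s ≟ i
  ... | yes s≡i = contradiction s≡i s≢i
  ... | no _ = refl

  zeroEntry-row : ∀ (i j : Fin n) R t →
    zeroEntry 𝓡 i j R i t ≡ (if does (t ≟ j) then 0# else R i t)
  zeroEntry-row i j R t with i ≟ i
  ... | yes _ = ≡.refl
  ... | no i≢i = contradiction ≡.refl i≢i

  split-keepOnly : ∀ (j : Fin n) u t →
    u t ≈ (if does (t ≟ j) then 0# else u t) + keepOnly j u t
  split-keepOnly j u t with t ≟ j
  ... | yes _ = sym (+-identityˡ (u t))
  ... | no _ = sym (+-identityʳ (u t))

  additive-zeroRow : AdditiveInRow F i → ∀ Z → (∀ t → Z i t ≈ 0#) → F Z ≈ 0#
  additive-zeroRow {F = F} F-add Z zi = x+x≈x⇒x≈0 (F Z) (sym (F-add Z Z Z same same 0≈0+0))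
    where
    same : AgreeOffRow _ Z Z
    same _ _ _ = refl
    0≈0+0 : ∀ t → Z _ t ≈ Z _ t + Z _ t
    0≈0+0 t = trans (zi t) (sym (trans (+-cong (zi t) (zi t)) (+-identityʳ 0#)))

  additive-expand : AdditiveInRow F i → ∀ m (w : Fin m → Fin n → Carrier) R Z →
    AgreeOffRow i R Z → (∀ t → Z i t ≈ Σ 𝓡 (λ j → w j t)) →
    F Z ≈ Σ 𝓡 (λ j → F (setRow i (w j) R))
  additive-expand F-add ℕ.zero w R Z rz zi = additive-zeroRow F-add Z zi
  additive-expand {F = F} {i = i} F-add (ℕ.suc m) w R Z rz zi = begin
    F Z
      ≈⟨ F-add (setRow i (w zero) R) Rest Z (agrees (w zero)) (agrees rest) row ⟩
    F (setRow i (w zero) R) + F Rest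
      ≈⟨ +-congˡ (additive-expand F-add m (w ∘ suc) R Rest rest-agrees (setRow-updates i rest R)) ⟩
    F (setRow i (w zero) R) + Σ 𝓡 (λ j → F (setRow i (w (suc j)) R))
      ∎
    where
    rest : Fin _ → Carrier
    rest t = Σ 𝓡 λ j → w (suc j) t
    Rest : Matrix 𝓡 _
    Rest = setRow i rest R
    agrees : ∀ v → AgreeOffRow i (setRow i v R) Z
    agrees v s t s≢i = trans (setRow-agrees i v R s t s≢i) (rz s t s≢i)
    rest-agrees : AgreeOffRow i R Rest
    rest-agrees s t s≢i = sym (setRow-agrees i rest R s t s≢i)
    row : ∀ t → Z i t ≈ setRow i (w zero) R i t + Rest i t
    row t = trans (zi t) (sym (+-cong (setRow-updates i (w zero) R t) (setRow-updates i rest R t)))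

  Σ-zeroEntry-row : ∀ {n} {F : Matrix 𝓡 n → Carrier} {i} → AdditiveInRow F i → ∀ R →
    Σ 𝓡 (λ j → F (zeroEntry 𝓡 i j R)) + F R ≈ n × F R
  Σ-zeroEntry-row {n} {F} {i} F-add R = begin
    Σ 𝓡 (F ∘ Rᵢ) + F R           ≈⟨ +-congˡ rows-sum ⟩
    Σ 𝓡 (F ∘ Rᵢ) + Σ 𝓡 (F ∘ E)   ≈⟨ Σ-distrib-+ (F ∘ Rᵢ) (F ∘ E) ⟨
    Σ 𝓡 (λ j → F (Rᵢ j) + F (E j)) ≈⟨ Σ-cong split ⟨
    Σ 𝓡 {n} (λ _ → F R)           ≈⟨ Σ-const n (F R) ⟩
    n × F R                       ∎
    where
    Rᵢ : Fin n → Matrix 𝓡 n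
    Rᵢ j = zeroEntry 𝓡 i j R
    E : Fin n → Matrix 𝓡 n
    E j = setRow i (keepOnly j (R i)) R
    rows-sum : F R ≈ Σ 𝓡 (F ∘ E)
    rows-sum = additive-expand F-add n (λ j → keepOnly j (R i)) R R (λ _ _ _ → refl)
      (λ t → sym (Σ-keepOnly (R i) t))
    split : ∀ j → F R ≈ F (Rᵢ j) + F (E j)
    split j = F-add (Rᵢ j) (E j) R (zeroEntry-agrees i j R) (setRow-agrees i _ R)
      λ t → trans (split-keepOnly j (R i) t)
        (sym (+-cong (reflexive (zeroEntry-row i j R t)) (setRow-updates i _ R t)))

  Σ-zeroEntry : ∀ {n} {F : Matrix 𝓡 n → Carrier} → (∀ i → AdditiveInRow F i) → ∀ R →
    fromℕ 𝓡 (n * n ∸ n) · F R ≈ Σ 𝓡 (λ i → Σ 𝓡 (λ j → F (zeroEntry 𝓡 i j R)))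
  Σ-zeroEntry {n} {F} F-add R = begin
    fromℕ 𝓡 (n * n ∸ n) · F R  ≈⟨ fromℕk·x≈k×x (n * n ∸ n) (F R) ⟩
    (n * n ∸ n) × F R          ≈⟨ +-cancelʳ (n × F R) _ _ with-n×FR ⟩
    Σ 𝓡 S                      ∎
    where
    S : Fin n → Carrier
    S i = Σ 𝓡 λ j → F (zeroEntry 𝓡 i j R)
    with-n×FR : (n * n ∸ n) × F R + n × F R ≈ Σ 𝓡 S + n × F R
    with-n×FR = begin
      (n * n ∸ n) × F R + n × F R  ≈⟨ ×-homo-+ (F R) (n * n ∸ n) n ⟨
      (n * n ∸ n ℕ.+ n) × F R      ≡⟨ ≡.cong (_× F R) (m∸n+n≡m (n≤n*n n)) ⟩
      (n * n) × F R                ≈⟨ ×-assocˡ (F R) n n ⟨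
      n × n × F R                  ≈⟨ Σ-const n (n × F R) ⟨
      Σ 𝓡 {n} (λ _ → n × F R)      ≈⟨ Σ-cong (λ i → Σ-zeroEntry-row (F-add i) R) ⟨
      Σ 𝓡 (λ i → S i + F R)        ≈⟨ Σ-distrib-+ S (λ _ → F R) ⟩
      Σ 𝓡 S + Σ 𝓡 {n} (λ _ → F R)  ≈⟨ +-congˡ (Σ-const n (F R)) ⟩
      Σ 𝓡 S + n × F R              ∎

lemma3p3 : ∀ {c ℓ : Level} (𝓡 : CommutativeRing c ℓ) (n : ℕ) (R : Matrix 𝓡 n) →
    CommutativeRing._≈_ 𝓡
      (CommutativeRing._*_ 𝓡 (fromℕ 𝓡 (n * n ∸ n)) (d₂ 𝓡 R))
      (Σ 𝓡 (λ i → Σ 𝓡 (λ j → d₂ 𝓡 (zeroEntry 𝓡 i j R))))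
lemma3p3 𝓡 n R = Σ-zeroEntry 𝓡 (d₂-additive 𝓡) R
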